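{- Every sentence in basic form $\bigvee_j\nabla(\vec T_j,\Pi_j,\Sigma_j)$ (with $\Sigma_j\cup\Pi_j\subseteq\vec T_j$ for each $j$) is equivalent to a sentence in basic form $\bigvee_j\nabla(\vec T'_j,\Pi'_j,\Sigma'_j)$ in which additionally $\Sigma'_j\subseteq\Pi'_j\subseteq\vec T'_j$ for every $j$.
   Context: Fix a finite set $A$ of monadic predicate symbols; sentences of $\mathtt{ME}^\infty(A)$ (monadic first-order logic with equality and the quantifiers $\exists^\infty$ "there are infinitely many" and $\forall^\infty$ "all but finitely many", in negation normal form) are interpreted on monadic models $(D,V)$, $V:A\to\wp(D)$, $D$ possibly empty; on the empty model $\exists,\exists^\infty$-sentences are false and $\forall,\forall^\infty$-sentences true. Sentences are equivalent if true in the same models. For $S\subseteq A$ let $\tau_S(x):=\bigwedge_{a\in S}a(x)\wedge\bigwedge_{a\in A\setminus S}\neg a(x)$; $\mathrm{diff}(y_1,\dots,y_n):=\bigwedge_{m<m'}y_m\not\approx y_{m'}$; $\mathrm{diff}(\vec y)\to\psi$ abbreviates $\bigvee_{m<m'}y_m\approx y_{m'}\vee\psi$; empty conjunction is $\top$, empty disjunction $\bot$. For $\vec T=(T_1,\dots,T_k)\in\wp(A)^k$ and $\Lambda\subseteq\wp(A)$: $\nabla(\vec T,\Lambda):=\exists x_1\cdots x_k.(\mathrm{diff}(\vec x)\wedge\bigwedge_i\tau_{T_i}(x_i)\wedge\forall z.(\mathrm{diff}(\vec x,z)\to\bigvee_{S\in\Lambda}\tau_S(z)))$; $\nabla_\infty(\Sigma):=\bigwedge_{S\in\Sigma}\exists^\infty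 y.\tau_S(y)\wedge\forall^\infty y.\bigvee_{S\in\Sigma}\tau_S(y)$; $\nabla(\vec T,\Pi,\Sigma):=\nabla(\vec T,\Pi\cup\Sigma)\wedge\nabla_\infty(\Sigma)$. A sentence in basic form is a finite disjunction of formulas $\nabla(\vec T,\Pi,\Sigma)$ with $\Sigma\cup\Pi\subseteq\{T_1,\dots,T_k\}$; inclusions in $\vec T$ mean inclusion in the set of its entries. -}

module Defs where

open import Data.Nat using (ℕ; zero; suc; _+_)
open import Data.Fin using (Fin; zero; suc)
open import Data.Fin.Subset using (Subset)
open import Data.Bool using (Bool; true; false)
open import Data.Vec using (lookup)
open import Data.List using (List; []; _∷_; map; foldr; _++_; allFin)
open import Data.List.Relation.Unary.All using (All)
open import Data.List.Membership.Propositional using (_∈_)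
import Data.Nat.Properties
open import Data.Product using (Σ; _×_; _,_)
open import Data.Sum using (_⊎_)
open import Data.Unit using (⊤)
open import Data.Empty using (⊥)
open import Relation.Nullary using (¬_)
open import Relation.Binary.PropositionalEquality using (_≡_)

-- The predicate symbols A are Fin n; a subset S ⊆ A is a 'Subset n'.

-- Syntax of ME^∞(A) in negation normal form, de Bruijn variables:
-- 'Formula n k' = formulas over A = Fin n with k free variables.

data Formula (n : ℕ) : ℕ → Set where
  tt ff      : ∀ {k} → Formula n k
  pos neg    : ∀ {k} → Fin n → Fin k → Formula n k
  eq neq     : ∀ {k} → Fin k → Fin k → Formula n k
  and or     : ∀ {k} → Formula n k → Formula n k → Formula n k
  ex all     : ∀ {k} → Formula n (suc k) → Formula n k
  exInf allInf : ∀ {k} → Formula n (suc k) → Formula n k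

Sentence : ℕ → Set
Sentence n = Formula n 0

-- Semantics: monadic models (D , V), D possibly empty.

record Model (n : ℕ) : Set₁ where
  field
    D : Set
    V : Fin n → D → Set

FinitelyMany : {D : Set} → (D → Set) → Set
FinitelyMany {D} P = Σ (List D) λ xs → ∀ d → P d → d ∈ xs

extend : {D : Set} {k : ℕ} → D → (Fin k → D) → Fin (suc k) → D
extend d ρ zero    = d
extend d ρ (suc i) = ρ i

module _ {n : ℕ} (M : Model n) where
  open Model M

  ⟦_⟧ : ∀ {k} → Formula n k → (Fin k → D) → Set
  ⟦ tt ⟧       ρ = ⊤
  ⟦ ff ⟧       ρ = ⊥
  ⟦ pos a x ⟧  ρ = V a (ρ x)
  ⟦ neg a x ⟧  ρ = ¬ V a (ρ x)
  ⟦ eq x y ⟧   ρ = ρ x ≡ ρ y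
  ⟦ neq x y ⟧  ρ = ¬ (ρ x ≡ ρ y)
  ⟦ and φ ψ ⟧  ρ = ⟦ φ ⟧ ρ × ⟦ ψ ⟧ ρ
  ⟦ or φ ψ ⟧   ρ = ⟦ φ ⟧ ρ ⊎ ⟦ ψ ⟧ ρ
  ⟦ ex φ ⟧     ρ = Σ D λ d → ⟦ φ ⟧ (extend d ρ)
  ⟦ all φ ⟧    ρ = ∀ d → ⟦ φ ⟧ (extend d ρ)
  ⟦ exInf φ ⟧  ρ = ¬ FinitelyMany (λ d → ⟦ φ ⟧ (extend d ρ))
  ⟦ allInf φ ⟧ ρ = FinitelyMany (λ d → ¬ ⟦ φ ⟧ (extend d ρ))

_⊨_ : ∀ {n} → Model n → Sentence n → Set
M ⊨ φ = ⟦ M ⟧ φ (λ ())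

Equivalent : ∀ {n} → Sentence n → Sentence n → Set₁
Equivalent {n} φ ψ = (M : Model n) → (M ⊨ φ → M ⊨ ψ) × (M ⊨ ψ → M ⊨ φ)

⋀ : ∀ {n k} → List (Formula n k) → Formula n k
⋀ = foldr and tt

⋁ : ∀ {n k} → List (Formula n k) → Formula n k
⋁ = foldr or ff

pairs : ∀ {k} → List (Fin k) → List (Fin k × Fin k)
pairs []       = []
pairs (x ∷ xs) = map (x ,_) xs ++ pairs xs

τ : ∀ {n k} → Subset n → Fin k → Formula n k
τ {n} S x = ⋀ (map lit (allFin n))
  where
  lit : Fin n → Formula _ _
  lit a with lookup S a
  ... | true  = pos a x
  ... | false = neg a x

diff : ∀ {n k} → List (Fin k) → Formula n k
diff ys = ⋀ (map (λ { (y , y') → neq y y' }) (pairs ys))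

-- diff(y⃗) → ψ   abbreviates   ⋁_{m<m'} y_m ≈ y_m' ∨ ψ
diff⇒ : ∀ {n k} → List (Fin k) → Formula n k → Formula n k
diff⇒ ys ψ = or (⋁ (map (λ { (y , y') → eq y y' }) (pairs ys))) ψ

exs : ∀ {n m} k → Formula n (k + m) → Formula n m
exs zero    φ = φ
exs (suc k) φ = exs k (ex φ)

-- ∇(T⃗, Λ), with T⃗ = (T_1,…,T_k) given as a function Fin k → ℘(A);
-- the bound variable x_i is the de Bruijn variable i.
∇ : ∀ {n} k → (Fin k → Subset n) → List (Subset n) → Sentence n
∇ {n} k T Λ = exs k body
  where
  xs : List (Fin (k + 0))
  xs = allFin (k + 0)
  Tx : Fin (k + 0) → Subset n
  Tx i = T (Data.Fin.cast (Data.Nat.Properties.+-identityʳ k) i)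
  body : Formula n (k + 0)
  body = and (diff xs)
        (and (⋀ (map (λ i → τ (Tx i) i) xs))
             (all (diff⇒ (map suc xs ++ (zero ∷ []))
                         (⋁ (map (λ S → τ S zero) Λ)))))

∇∞ : ∀ {n} → List (Subset n) → Sentence n
∇∞ Σs = and (⋀ (map (λ S → exInf (τ S zero)) Σs))
            (allInf (⋁ (map (λ S → τ S zero) Σs)))

record Triple (n : ℕ) : Set where
  constructor triple
  field
    k  : ℕ
    T  : Fin k → Subset n
    Π  : List (Subset n)
    Σs : List (Subset n)

∇₃ : ∀ {n} → Triple n → Sentence n
∇₃ (triple k T Π Σs) = and (∇ k T (Π ++ Σs)) (∇∞ Σs)

_⊆T_ : ∀ {n k} → List (Subset n) → (Fin k → Subset n) → Set
Λ ⊆T T = All (λ S → Σ _ λ i → T i ≡ S) Λ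

_⊆L_ : ∀ {n} → List (Subset n) → List (Subset n) → Set
Λ ⊆L Λ' = All (λ S → S ∈ Λ') Λ

BasicCond : ∀ {n} → Triple n → Set
BasicCond (triple k T Π Σs) = (Σs ⊆T T) × (Π ⊆T T)

StrongCond : ∀ {n} → Triple n → Set
StrongCond (triple k T Π Σs) = (Σs ⊆L Π) × (Π ⊆T T)

basicSentence : ∀ {n} → List (Triple n) → Sentence n
basicSentence ts = ⋁ (map ∇₃ ts)

-- In ∇(T⃗, Π, Σ) the elements outside x⃗ already range over Π ∪ Σ, so replacing Π by
-- Π ∪ Σ changes neither ∇(T⃗, Π ∪ Σ) nor ∇∞(Σ), while the basic-form condition
-- Σ ∪ Π ⊆ T⃗ turns into Σ ⊆ Π ∪ Σ ⊆ T⃗.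
module Submission where

open import Defs
open import Data.Nat using (ℕ; suc; _+_)
open import Data.Fin using (Fin; zero)
open import Data.List using (List; []; _∷_; map; _++_)
open import Data.List.Relation.Unary.All using (All; tabulate)
import Data.List.Relation.Unary.All.Properties as Allₚ
open import Data.List.Relation.Unary.Any using (Any; here; there)
import Data.List.Relation.Unary.Any.Properties as Anyₚ
open import Data.List.Membership.Propositional.Properties using (∈-++⁺ʳ; ∈-++⁻)
open import Data.List.Relation.Binary.Subset.Propositional using (_⊆_)
open import Data.List.Relation.Binary.Subset.Propositional.Properties
  using (Any-resp-⊆; xs⊆xs++ys; xs⊆ys++xs)
open import Data.Fin.Subset using (Subset)
open import Data.Product using (Σ-syntax; _×_; _,_)
open import Data.Sum using (inj₁; inj₂; [_,_]′)
import Data.Sum as Sum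
open import Function using (_∘_; id)

module _ {n : ℕ} (M : Model n) where
  open Model M

  ⟦⋁⟧⇒Any : ∀ {k} (φs : List (Formula n k)) {ρ : Fin k → D} →
    ⟦ M ⟧ (⋁ φs) ρ → Any (λ φ → ⟦ M ⟧ φ ρ) φs
  ⟦⋁⟧⇒Any (φ ∷ φs) (inj₁ p) = here p
  ⟦⋁⟧⇒Any (φ ∷ φs) (inj₂ p) = there (⟦⋁⟧⇒Any φs p)

  Any⇒⟦⋁⟧ : ∀ {k} {φs : List (Formula n k)} {ρ : Fin k → D} →
    Any (λ φ → ⟦ M ⟧ φ ρ) φs → ⟦ M ⟧ (⋁ φs) ρ
  Any⇒⟦⋁⟧ (here p)  = inj₁ p
  Any⇒⟦⋁⟧ (there p) = inj₂ (Any⇒⟦⋁⟧ p)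

  ⋁-map-mono : ∀ {k} {A : Set} (f : A → Formula n k) {xs ys : List A} → xs ⊆ ys →
    ∀ {ρ} → ⟦ M ⟧ (⋁ (map f xs)) ρ → ⟦ M ⟧ (⋁ (map f ys)) ρ
  ⋁-map-mono f xs⊆ys =
    Any⇒⟦⋁⟧ ∘ Anyₚ.map⁺ ∘ Any-resp-⊆ xs⊆ys ∘ Anyₚ.map⁻ ∘ ⟦⋁⟧⇒Any (map f _)

  exs-mono : ∀ k {m} {φ ψ : Formula n (k + m)} →
    (∀ ρ → ⟦ M ⟧ φ ρ → ⟦ M ⟧ ψ ρ) → ∀ ρ → ⟦ M ⟧ (exs k φ) ρ → ⟦ M ⟧ (exs k ψ) ρ
  exs-mono 0       φ⇒ψ = φ⇒ψ
  exs-mono (suc k) φ⇒ψ = exs-mono k λ { ρ (d , p) → d , φ⇒ψ (extend d ρ) p }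

  ∇-mono : ∀ k (T : Fin k → Subset n) {Λ Λ' : List (Subset n)} → Λ ⊆ Λ' →
    M ⊨ ∇ k T Λ → M ⊨ ∇ k T Λ'
  ∇-mono k T Λ⊆Λ' = exs-mono k (λ { ρ (distinct , typed , rest) →
    distinct , typed , λ d → Sum.map₂ (⋁-map-mono (λ S → τ S zero) Λ⊆Λ') (rest d) }) _

saturate : ∀ {n} → Triple n → Triple n
saturate (triple k T Π Σs) = triple k T (Π ++ Σs) Σs

saturate-strong : ∀ {n} {t : Triple n} → BasicCond t → StrongCond (saturate t)
saturate-strong {t = triple k T Π Σs} (Σs⊆T , Π⊆T) =
  tabulate (∈-++⁺ʳ Π) , Allₚ.++⁺ Π⊆T Σs⊆T

++-absorbʳ : ∀ {A : Set} (xs ys : List A) → (xs ++ ys) ++ ys ⊆ xs ++ ys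
++-absorbʳ xs ys = [ id , xs⊆ys++xs ys xs ]′ ∘ ∈-++⁻ (xs ++ ys)

module _ {n : ℕ} (M : Model n) where

  ∇₃-saturate⁺ : ∀ t → M ⊨ ∇₃ t → M ⊨ ∇₃ (saturate t)
  ∇₃-saturate⁺ (triple k T Π Σs) (p , q) =
    ∇-mono M k T (xs⊆xs++ys (Π ++ Σs) Σs) p , q

  ∇₃-saturate⁻ : ∀ t → M ⊨ ∇₃ (saturate t) → M ⊨ ∇₃ t
  ∇₃-saturate⁻ (triple k T Π Σs) (p , q) =
    ∇-mono M k T (++-absorbʳ Π Σs) p , q

  basicSentence-map⁺ : (f : Triple n → Triple n) → (∀ t → M ⊨ ∇₃ t → M ⊨ ∇₃ (f t)) →
    ∀ ts → M ⊨ basicSentence ts → M ⊨ basicSentence (map f ts)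
  basicSentence-map⁺ f ∇₃⇒ (t ∷ ts) (inj₁ p) = inj₁ (∇₃⇒ t p)
  basicSentence-map⁺ f ∇₃⇒ (t ∷ ts) (inj₂ p) = inj₂ (basicSentence-map⁺ f ∇₃⇒ ts p)

  basicSentence-map⁻ : (f : Triple n → Triple n) → (∀ t → M ⊨ ∇₃ (f t) → M ⊨ ∇₃ t) →
    ∀ ts → M ⊨ basicSentence (map f ts) → M ⊨ basicSentence ts
  basicSentence-map⁻ f ⇒∇₃ (t ∷ ts) (inj₁ p) = inj₁ (⇒∇₃ t p)
  basicSentence-map⁻ f ⇒∇₃ (t ∷ ts) (inj₂ p) = inj₂ (basicSentence-map⁻ f ⇒∇₃ ts p)

proposition3p16 : ∀ {n} (ts : List (Triple n)) → All BasicCond ts →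
    Σ[ ts' ∈ List (Triple n) ] (All StrongCond ts' × Equivalent (basicSentence ts) (basicSentence ts'))
proposition3p16 ts basic =
  map saturate ts ,
  Allₚ.gmap⁺ saturate-strong basic ,
  λ M → basicSentence-map⁺ M saturate (∇₃-saturate⁺ M) ts
      , basicSentence-map⁻ M saturate (∇₃-saturate⁻ M) ts
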